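{- There exists a nontotal partial combinatory algebra $\mathcal{A}$ in which $\bar 0$ and $\bar 1$ are not separable.
   Context: A pca $\mathcal{A}$ is a set with a partial, left-associative, strict application that is combinatory complete; equivalently it has $k,s$ with $kab=a$, $sab\downarrow$, $sabc\simeq ac(bc)$. It is nontotal if $ab$ is undefined for some $a,b$. With combinatory abstraction $\lambda^*$, put $i=skk$, $\mathsf{false}=ki$, $\langle a,b\rangle=\lambda^*z.zab$, numerals $\bar 0=i$, $\bar 1=\langle\mathsf{false},\bar 0\rangle$. $\bar 0,\bar 1$ are separable in $\mathcal{A}$ if there is $c\in\mathcal{A}$ with $ca$ defined and in $\{\bar 0,\bar 1\}$ for all $a$, such that $ca=\bar 0\Rightarrow a\ne\bar 1$ and $ca=\bar 1\Rightarrow a\ne\bar 0$. -}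

module Defs where

open import Data.Product using (Σ; ∃; _×_; _,_)
open import Data.Sum using (_⊎_)
open import Relation.Nullary using (¬_)
open import Relation.Binary.PropositionalEquality using (_≡_; _≢_)

data Tm (A : Set) : Set where
  con : A → Tm A
  _∙_ : Tm A → Tm A → Tm A

infixl 7 _∙_

data _⊢_⇓_ {A : Set} (app : A → A → A → Set) : Tm A → A → Set where
  ⇓con : ∀ {a} → app ⊢ con a ⇓ a
  ⇓app : ∀ {t u x y v} → app ⊢ t ⇓ x → app ⊢ u ⇓ y → app x y v →
         app ⊢ t ∙ u ⇓ v

record PCA : Set₁ where
  field
    Carrier : Set
    _·_↝_   : Carrier → Carrier → Carrier → Set
    ·-functional : ∀ {a b c d} → a · b ↝ c → a · b ↝ d → c ≡ d
    k s : Carrier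

  _⇓_ : Tm Carrier → Carrier → Set
  t ⇓ v = _·_↝_ ⊢ t ⇓ v

  _↓ : Tm Carrier → Set
  t ↓ = ∃ λ v → t ⇓ v

  field
    k-ax : ∀ a b → (con k ∙ con a ∙ con b) ⇓ a
    s-def : ∀ a b → (con s ∙ con a ∙ con b) ↓
    -- s a b c ≃ a c (b c)   (Kleene equality)
    s-ax₁ : ∀ a b c d → (con s ∙ con a ∙ con b ∙ con c) ⇓ d →
            (con a ∙ con c ∙ (con b ∙ con c)) ⇓ d
    s-ax₂ : ∀ a b c d → (con a ∙ con c ∙ (con b ∙ con c)) ⇓ d →
            (con s ∙ con a ∙ con b ∙ con c) ⇓ d

module PCANotions (𝒜 : PCA) where
  open PCA 𝒜

  K S : Tm Carrier
  K = con k
  S = con s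

  -- Combinatory abstraction λ*z.z a b  (variable-free input a, b):
  --   λ*z.z = s k k,  λ*z.c = k c,  λ*z.(t u) = s (λ*z.t) (λ*z.u)
  iTm : Tm Carrier
  iTm = S ∙ K ∙ K

  falseTm : Tm Carrier
  falseTm = K ∙ iTm

  -- ⟨a , b⟩ = λ*z. z a b = s (s i (k a)) (k b)
  pairTm : Tm Carrier → Tm Carrier → Tm Carrier
  pairTm a b = S ∙ (S ∙ iTm ∙ (K ∙ a)) ∙ (K ∙ b)

  zeroTm : Tm Carrier
  zeroTm = iTm

  oneTm : Tm Carrier
  oneTm = pairTm falseTm zeroTm

  Is0 Is1 : Carrier → Set
  Is0 x = zeroTm ⇓ x
  Is1 x = oneTm ⇓ x

  Nontotal : Set
  Nontotal = ∃ λ a → ∃ λ b → ∀ c → ¬ (a · b ↝ c)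

  Separable01 : Set
  Separable01 =
    ∃ λ c → ∀ a → ∃ λ r → (c · a ↝ r) × (Is0 r ⊎ Is1 r)
                         × (Is0 r → ¬ Is1 a) × (Is1 r → ¬ Is0 a)

-- The model is the term model of the combinators k and s over a countable
-- set of inert atoms.  Values are atoms, k, s and the partial applications
-- k a, s a, s a b.  An atom applied to anything is undefined, which makes
-- the algebra nontotal.  Reduction never inspects atoms, so substituting a
-- value for an atom preserves application (a homomorphism).
--
-- Suppose c separated 0̄ and 1̄.  Apply c to an atom x that does not occur
-- in c.  The result r is 0̄ or 1̄, and both are closed.  Substituting any a
-- for x then shows c · a ↝ r for every a; in particular c · 0̄ = c · 1̄.
-- In any pca a separator cannot give 0̄ and 1̄ the same value, so no
-- separator exists.
module Submission where

open import Defs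
open import Data.Product using (Σ; _×_; _,_)
open import Data.Sum using (_⊎_; inj₁; inj₂)
open import Data.Empty using (⊥)
open import Relation.Nullary using (¬_; yes; no; contradiction)
open import Data.Nat using (ℕ; suc; _≤_; z≤n; _⊔_; _≟_)
open import Data.Nat.Properties using (m≤m⊔n; m≤n⊔m; ≤-trans; ≤-refl; n≮n)
open import Relation.Binary.PropositionalEquality
  using (_≡_; refl; trans; subst; cong; cong₂)

⇓-functional : ∀ {A : Set} {app : A → A → A → Set} →
               (∀ {a b c d} → app a b c → app a b d → c ≡ d) →
               ∀ {t x y} → app ⊢ t ⇓ x → app ⊢ t ⇓ y → x ≡ y
⇓-functional fun ⇓con ⇓con = refl
⇓-functional fun (⇓app t⇓ u⇓ r) (⇓app t⇓′ u⇓′ r′)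
  with ⇓-functional fun t⇓ t⇓′ | ⇓-functional fun u⇓ u⇓′
... | refl | refl = fun r r′

module _ (𝒫 : PCA) where
  open PCA 𝒫
  open PCANotions 𝒫

  Separates : Carrier → Set
  Separates c = ∀ a → Σ Carrier λ r → (c · a ↝ r) × (Is0 r ⊎ Is1 r)
                       × (Is0 r → ¬ Is1 a) × (Is1 r → ¬ Is0 a)

  -- A separator never sends 0̄ and 1̄ to the same value.  The value on 1̄
  -- cannot be 0̄, and the value on 0̄ cannot be 1̄.
  separator-splits : ∀ {c z o r} → Separates c → Is0 z → Is1 o →
                     c · z ↝ r → c · o ↝ r → ⊥
  separator-splits {z = z} {o} sep z0 o1 cz co with sep o
  ... | _ , _ , inj₁ r₂0 , not1 , _ = not1 r₂0 o1
  ... | _ , co₂ , inj₂ r₂1 , _ , _ with sep z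
  ...   | _ , cz₁ , _ , _ , not0 =
    not0 (subst Is1 (trans (·-functional co₂ co) (·-functional cz cz₁)) r₂1) z0

data V : Set where
  atom   : ℕ → V
  k₀ s₀  : V
  k₁ s₁  : V → V
  s₂     : V → V → V

-- One-step application.  It is the graph of a recursively described partial
-- function.  Atoms never occur in head position, so atom · a is undefined.
infix 4 _·_↝_
data _·_↝_ : V → V → V → Set where
  k·  : ∀ {a} → k₀ · a ↝ k₁ a
  k₁· : ∀ {a b} → k₁ a · b ↝ a
  s·  : ∀ {a} → s₀ · a ↝ s₁ a
  s₁· : ∀ {a b} → s₁ a · b ↝ s₂ a b
  s₂· : ∀ {a b c x y d} → a · c ↝ x → b · c ↝ y → x · y ↝ d → s₂ a b · c ↝ d

·-functional : ∀ {a b c d} → a · b ↝ c → a · b ↝ d → c ≡ d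
·-functional k·  k·  = refl
·-functional k₁· k₁· = refl
·-functional s·  s·  = refl
·-functional s₁· s₁· = refl
·-functional (s₂· p q r) (s₂· p′ q′ r′)
  with ·-functional p p′ | ·-functional q q′
... | refl | refl = ·-functional r r′

s-reduces : ∀ a b c d → _·_↝_ ⊢ (con s₀ ∙ con a ∙ con b ∙ con c) ⇓ d →
            _·_↝_ ⊢ (con a ∙ con c ∙ (con b ∙ con c)) ⇓ d
s-reduces a b c d (⇓app (⇓app (⇓app ⇓con ⇓con s·) ⇓con s₁·) ⇓con (s₂· p q r)) =
  ⇓app (⇓app ⇓con ⇓con p) (⇓app ⇓con ⇓con q) r

s-expands : ∀ a b c d → _·_↝_ ⊢ (con a ∙ con c ∙ (con b ∙ con c)) ⇓ d →
            _·_↝_ ⊢ (con s₀ ∙ con a ∙ con b ∙ con c) ⇓ d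
s-expands a b c d (⇓app (⇓app ⇓con ⇓con p) (⇓app ⇓con ⇓con q) r) =
  ⇓app (⇓app (⇓app ⇓con ⇓con s·) ⇓con s₁·) ⇓con (s₂· p q r)

termModel : PCA
termModel = record
  { Carrier      = V
  ; _·_↝_        = _·_↝_
  ; ·-functional = ·-functional
  ; k            = k₀
  ; s            = s₀
  ; k-ax         = λ a b → ⇓app (⇓app ⇓con ⇓con k·) ⇓con k₁·
  ; s-def        = λ a b → s₂ a b , ⇓app (⇓app ⇓con ⇓con s·) ⇓con s₁·
  ; s-ax₁        = s-reduces
  ; s-ax₂        = s-expands
  }

infix 8 _[_≔_]
_[_≔_] : V → ℕ → V → V
atom m [ n ≔ a ] with n ≟ m
... | yes _ = a
... | no  _ = atom m
k₀       [ n ≔ a ] = k₀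
s₀       [ n ≔ a ] = s₀
k₁ x     [ n ≔ a ] = k₁ (x [ n ≔ a ])
s₁ x     [ n ≔ a ] = s₁ (x [ n ≔ a ])
s₂ x y   [ n ≔ a ] = s₂ (x [ n ≔ a ]) (y [ n ≔ a ])

-- Substitution is a homomorphism for application, since no rule looks
-- at an atom.
·-subst : ∀ n a {x y z} → x · y ↝ z → x [ n ≔ a ] · y [ n ≔ a ] ↝ z [ n ≔ a ]
·-subst n a k·          = k·
·-subst n a k₁·         = k₁·
·-subst n a s·          = s·
·-subst n a s₁·         = s₁·
·-subst n a (s₂· p q r) = s₂· (·-subst n a p) (·-subst n a q) (·-subst n a r)

atom-subst : ∀ n a → atom n [ n ≔ a ] ≡ a
atom-subst n a with n ≟ n
... | yes _ = refl
... | no  n≢n = contradiction refl n≢n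

atomBound : V → ℕ
atomBound (atom m) = suc m
atomBound k₀       = 0
atomBound s₀       = 0
atomBound (k₁ x)   = atomBound x
atomBound (s₁ x)   = atomBound x
atomBound (s₂ x y) = atomBound x ⊔ atomBound y

fresh-subst : ∀ {n} a x → atomBound x ≤ n → x [ n ≔ a ] ≡ x
fresh-subst {n} a (atom m) bound with n ≟ m
... | yes refl = contradiction bound (n≮n n)
... | no  _    = refl
fresh-subst a k₀       bound = refl
fresh-subst a s₀       bound = refl
fresh-subst a (k₁ x)   bound = cong k₁ (fresh-subst a x bound)
fresh-subst a (s₁ x)   bound = cong s₁ (fresh-subst a x bound)
fresh-subst a (s₂ x y) bound =
  cong₂ s₂ (fresh-subst a x (≤-trans (m≤m⊔n (atomBound x) (atomBound y)) bound))
           (fresh-subst a y (≤-trans (m≤n⊔m (atomBound x) (atomBound y)) bound))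

fresh-atom-generic : ∀ {n c r} → atomBound c ≤ n → atomBound r ≤ n →
                     c · atom n ↝ r → ∀ a → c · a ↝ r
fresh-atom-generic {n} {c} {r} c-fresh r-fresh c·n a
  with ·-subst n a c·n
... | substituted
  rewrite fresh-subst a c c-fresh | fresh-subst a r r-fresh | atom-subst n a =
  substituted

open PCANotions termModel

zeroV oneV : V
zeroV = s₂ k₀ k₀
oneV  = s₂ (s₂ zeroV (k₁ (k₁ zeroV))) (k₁ zeroV)

is0-zeroV : Is0 zeroV
is0-zeroV = ⇓app (⇓app ⇓con ⇓con s·) ⇓con s₁·

is1-oneV : Is1 oneV
is1-oneV = ⇓app (⇓app ⇓con (⇓app (⇓app ⇓con is0-zeroV s·) kFalse s₁·) s·)
                (⇓app ⇓con is0-zeroV k·) s₁·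
  where
  kFalse : _·_↝_ ⊢ K ∙ falseTm ⇓ k₁ (k₁ zeroV)
  kFalse = ⇓app ⇓con (⇓app ⇓con is0-zeroV k·) k·

numeral-closed : ∀ {r n} → Is0 r ⊎ Is1 r → atomBound r ≤ n
numeral-closed (inj₁ r0)
  rewrite ⇓-functional ·-functional r0 is0-zeroV = z≤n
numeral-closed (inj₂ r1)
  rewrite ⇓-functional ·-functional r1 is1-oneV = z≤n

not-separable : ¬ Separable01
not-separable (c , sep) with sep (atom (atomBound c))
... | r , c·x , r-numeral , _ =
  separator-splits termModel sep is0-zeroV is1-oneV (constant zeroV) (constant oneV)
  where
  constant : ∀ a → c · a ↝ r
  constant = fresh-atom-generic ≤-refl (numeral-closed r-numeral) c·x

theorem8p5 : Σ PCA (λ 𝒜 → PCANotions.Nontotal 𝒜 × ¬ PCANotions.Separable01 𝒜)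
theorem8p5 = termModel , (atom 0 , atom 0 , λ c ()) , not-separable
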